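{- The optimal value of the linear program $$\max\sum_{i\in I}\sum_{S\in\Lambda_i}g_i(S)x_{i,S}$$ subject to $\sum_{S\in\Lambda_i}x_{i,S}\le1$ for all $i\in I$; $\sum_{S\in\Lambda_{ij}}x_{i,S}\le r_j$ for all $j\in J$ and $(i,j)\in E$; $\sum_{i\in\mathcal{N}_j}\sum_{S\in\Lambda_{ij}}x_{i,S}\le r_jb_j$ for all $j\in J$; $x_{i,S}\ge0$ for all $i\in I,S\in\Lambda_i$, is an upper bound on the expected objective value of a clairvoyant optimum for ONline Capacitated Submodular Maximization.
   Context: ONline Capacitated Submodular Maximization: bipartite graph $G=(I,J,E)$ with offline task types $I$ and online worker types $J$; $\mathcal{N}_\ell$ = neighbours of node $\ell$; positive integer capacities $b_i,b_j$; horizon $T$; rates $r_j>0$ with $\sum_jr_j=T$; in each of $T$ rounds one worker arrives independently, of type $j$ with probability $r_j/T$ (multiple arrivals of a type treated as distinct workers). Each task $i$ has a monotone submodular $g_i\ge0$ on subsets of $\mathcal{N}_i$ with $g_i(\emptyset)=0$. An arriving worker of type $j$ can be assigned to at most $b_j$ tasks of $\mathcal{N}_j$, each task $i$ receives at most $b_i$ workers; the objective is $\sum_ig_i(S_i)$ with $S_i$ the set assigned to $i$. A clairvoyant optimum knows the whole arrival sequence in advance and then chooses a best feasible assignment. Notation: $\Lambda_i=\{S\subseteq\mathcal{N}_i:|S|\le b_i\}$ and $\Lambda_{ij}=\{S\in\Lambda_i:j\in S\}$.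
   Formalization: The rates $r_j$ and the values $g_i(S)$ of the monotone submodular functions are rational. -}

module Defs where

open import Data.Bool using (Bool; true; false; if_then_else_; _∧_; T)
open import Data.Nat as ℕ using (ℕ; zero; suc; NonZero)
open import Data.Integer using (+_)
open import Data.Fin using (Fin)
open import Data.Fin.Subset using (Subset; ⊥; ⁅_⁆; _∪_; _∈_; _∉_; _⊆_; ∣_∣)
open import Data.Vec using (Vec; []; _∷_; lookup)
open import Data.List using (List; []; _∷_; map; concatMap; filter; allFin; foldr)
open import Data.Rational using (ℚ; 0ℚ; 1ℚ; _+_; _-_; _*_; _/_; _≤_)
open import Relation.Nullary.Decidable using (Dec; yes; no)
open import Relation.Binary.PropositionalEquality using (_≡_)
open import Data.Product using (_×_)
open import Data.List.Membership.Propositional using () renaming (_∈_ to _∈L_)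

ΣL : {A : Set} → List A → (A → ℚ) → ℚ
ΣL xs f = foldr (λ a acc → f a + acc) 0ℚ xs

ΠL : {A : Set} → List A → (A → ℚ) → ℚ
ΠL xs f = foldr (λ a acc → f a * acc) 1ℚ xs

ΣF : (n : ℕ) → (Fin n → ℚ) → ℚ
ΣF n f = ΣL (allFin n) f

countF : (n : ℕ) → (Fin n → Bool) → ℕ
countF n p = foldr (λ a acc → if p a then suc acc else acc) 0 (allFin n)

ℕ→ℚ : ℕ → ℚ
ℕ→ℚ n = + n / 1

allSubsets : (n : ℕ) → List (Subset n)
allSubsets zero    = [] ∷ []
allSubsets (suc n) = concatMap (λ S → (false ∷ S) ∷ (true ∷ S) ∷ []) (allSubsets n)

allSeqs : (m t : ℕ) → List (Vec (Fin m) t)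
allSeqs m zero    = [] ∷ []
allSeqs m (suc t) = concatMap (λ s → map (λ j → j ∷ s) (allFin m)) (allSeqs m t)

isSubsetB : {n : ℕ} → Subset n → Subset n → Bool
isSubsetB []          []          = true
isSubsetB (false ∷ p) (_ ∷ q)     = isSubsetB p q
isSubsetB (true ∷ p)  (true ∷ q)  = isSubsetB p q
isSubsetB (true ∷ p)  (false ∷ q) = false

leqB : ℕ → ℕ → Bool
leqB zero    _       = true
leqB (suc m) zero    = false
leqB (suc m) (suc n) = leqB m n

-- Tasks: Fin nI, worker types: Fin nJ.
-- The bipartite graph is given by the neighbourhoods N_i ⊆ J of tasks:
-- (i , j) ∈ E  iff  j ∈ Nb i.  Then N_j = { i | j ∈ Nb i }.

Λ : {nI nJ : ℕ} → (Nb : Fin nI → Subset nJ) → (bI : Fin nI → ℕ) → Fin nI → List (Subset nJ)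
Λ Nb bI i = filter (λ S → T? (isSubsetB S (Nb i) ∧ leqB ∣ S ∣ (bI i))) (allSubsets _)
  where
  T? : (b : Bool) → Dec (T b)
  T? true  = yes _
  T? false = no (λ ())

Λ₂ : {nI nJ : ℕ} → (Nb : Fin nI → Subset nJ) → (bI : Fin nI → ℕ) → Fin nI → Fin nJ → List (Subset nJ)
Λ₂ Nb bI i j = filter (λ S → T? (lookup S j)) (Λ Nb bI i)
  where
  T? : (b : Bool) → Dec (T b)
  T? true  = yes _
  T? false = no (λ ())

Monotone : {n : ℕ} → Subset n → (Subset n → ℚ) → Set
Monotone N g = ∀ A B → A ⊆ B → B ⊆ N → g A ≤ g B

Submodular : {n : ℕ} → Subset n → (Subset n → ℚ) → Set
Submodular N g = ∀ A B j → A ⊆ B → B ⊆ N → j ∈ N → j ∉ B →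
  g (B ∪ ⁅ j ⁆) - g B ≤ g (A ∪ ⁅ j ⁆) - g A

-- LP feasibility and objective.  x i S is the variable x_{i,S}
-- (only values with S ∈ Λ_i are ever used).

LPFeasible : {nI nJ : ℕ} → (Nb : Fin nI → Subset nJ) → (bI : Fin nI → ℕ) →
  (bJ : Fin nJ → ℕ) → (r : Fin nJ → ℚ) → (x : Fin nI → Subset nJ → ℚ) → Set
LPFeasible {nI} {nJ} Nb bI bJ r x =
  (∀ i → ΣL (Λ Nb bI i) (x i) ≤ 1ℚ)
  × (∀ j i → j ∈ Nb i → ΣL (Λ₂ Nb bI i j) (x i) ≤ r j)
  × (∀ j → ΣF nI (λ i → if lookup (Nb i) j then ΣL (Λ₂ Nb bI i j) (x i) else 0ℚ)
              ≤ r j * ℕ→ℚ (bJ j))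
  × (∀ i S → S ∈L Λ Nb bI i → 0ℚ ≤ x i S)

LPObjective : {nI nJ : ℕ} → (Nb : Fin nI → Subset nJ) → (bI : Fin nI → ℕ) →
  (g : Fin nI → Subset nJ → ℚ) → (x : Fin nI → Subset nJ → ℚ) → ℚ
LPObjective {nI} Nb bI g x = ΣF nI (λ i → ΣL (Λ Nb bI i) (λ S → g i S * x i S))

-- Clairvoyant assignments for a realised arrival sequence s
-- (s t = type of the worker arriving in round t; arrivals are distinct workers).
-- A t i = true  iff the worker of round t is assigned to task i.

Assignment : (nI T : ℕ) → Set
Assignment nI T = Fin T → Fin nI → Bool

FeasibleAssignment : {nI nJ T : ℕ} → (Nb : Fin nI → Subset nJ) → (bI : Fin nI → ℕ) →
  (bJ : Fin nJ → ℕ) → Vec (Fin nJ) T → Assignment nI T → Set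
FeasibleAssignment {nI} {nJ} {T'} Nb bI bJ s A =
  (∀ t i → A t i ≡ true → lookup s t ∈ Nb i)
  × (∀ t → countF nI (λ i → A t i) ℕ.≤ bJ (lookup s t))
  × (∀ i → countF T' (λ t → A t i) ℕ.≤ bI i)

-- set of worker types assigned to task i  (S_i, seen through the types)
assignedTypes : {nI nJ T : ℕ} → Vec (Fin nJ) T → Assignment nI T → Fin nI → Subset nJ
assignedTypes {T = T'} s A i =
  foldr (λ t acc → if A t i then ⁅ lookup s t ⁆ ∪ acc else acc) ⊥ (allFin T')

assignmentValue : {nI nJ T : ℕ} → (g : Fin nI → Subset nJ → ℚ) →
  Vec (Fin nJ) T → Assignment nI T → ℚ
assignmentValue {nI} g s A = ΣF nI (λ i → g i (assignedTypes s A i))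

seqProb : {nJ : ℕ} → (T : ℕ) → .{{_ : NonZero T}} → (r : Fin nJ → ℚ) → Vec (Fin nJ) T → ℚ
seqProb T r s = ΠL (allFin T) (λ t → r (lookup s t) * (+ 1 / T))

expectedValue : {nI nJ : ℕ} → (T : ℕ) → .{{_ : NonZero T}} → (r : Fin nJ → ℚ) →
  (g : Fin nI → Subset nJ → ℚ) → (A : Vec (Fin nJ) T → Assignment nI T) → ℚ
expectedValue {nJ = nJ} T r g A =
  ΣL (allSeqs nJ T) (λ s → seqProb T r s * assignmentValue g s (A s))

-- Let x_{i,S} be the probability, over the arrival sequence, that the
-- clairvoyant assignment gives task i exactly the set S of worker types.
-- Then the LP objective at x is the expected value of the assignment, and
-- every constraint is an expectation of a per-sequence inequality: task i
-- receives exactly one set; type j belongs to S_i only if j arrived; and the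
-- tasks holding j number at most b_j times the arrivals of j.  Arrivals are
-- i.i.d. with law r_j / T, so type j is expected to arrive T · r_j / T = r_j
-- times.
module Submission where

open import Defs
open import Data.Nat as ℕ using (ℕ; NonZero)
open import Data.Fin using (Fin)
open import Data.Fin.Subset using (Subset; ⊥; _⊆_)
open import Data.Vec using (Vec)
open import Data.Rational using (ℚ; 0ℚ; _≤_; _<_)
open import Data.Product using (Σ; _×_)
open import Relation.Binary.PropositionalEquality using (_≡_)

open import Algebra.Bundles using (CommutativeMonoid)
import Algebra.Properties.CommutativeSemigroup as CommSemigroupProperties
open import Data.Bool using (Bool; true; false; if_then_else_; _∧_; _∨_; T)
import Data.Bool.Properties as Bool
open import Data.Fin using (zero; suc; _≟_)
open import Data.Fin.Subset using (⁅_⁆; _∪_; _∈_; ∣_∣)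
open import Data.Fin.Subset.Properties using (⊥⊆; x∈p∪q⁻; x∈⁅y⁆⇒x≡y; ∣⊥∣≡0; ∣⁅x⁆∣≡1; drop-∷-⊆)
import Data.Integer as ℤ
import Data.Integer.Properties as ℤ
open import Data.List using (List; []; _∷_; map; concatMap; filter; allFin; foldr; _++_)
open import Data.List.Properties using (map-tabulate)
open import Data.Nat using (zero; suc; z≤n; s≤s)
open import Data.Nat.Coprimality as Coprime using (1-coprimeTo)
import Data.Nat.Properties as ℕ
open import Data.Product using (_,_; proj₁; proj₂)
open import Data.Rational using (mkℚ; 1ℚ; _+_; _*_; _/_; nonNegative)
open import Data.Rational.Properties hiding (_≟_)
open import Data.Rational.Solver using (module +-*-Solver)
open import Data.Sum using (inj₁; inj₂)
open import Data.Vec using ([]; _∷_; lookup; here)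
open import Data.Vec.Properties using (≡-dec; lookup-zipWith; lookup-replicate)
open import Function using (_∘_; id)
open import Relation.Binary.Definitions using (DecidableEquality)
open import Relation.Binary.PropositionalEquality
  using (refl; sym; trans; cong; cong₂; subst; module ≡-Reasoning)
open import Relation.Nullary.Decidable using (Dec; yes; no; does; dec-true; dec-false)
open import Relation.Unary using (Decidable)

open CommSemigroupProperties (CommutativeMonoid.commutativeSemigroup +-0-commutativeMonoid)
  using () renaming (interchange to +-interchange)
open CommSemigroupProperties (CommutativeMonoid.commutativeSemigroup *-1-commutativeMonoid)
  using () renaming (x∙yz≈y∙xz to x*yz≡y*xz)

*-nonNeg : ∀ {a b} → 0ℚ ≤ a → 0ℚ ≤ b → 0ℚ ≤ a * b
*-nonNeg {a} {b} 0≤a 0≤b =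
  nonNegative⁻¹ (a * b) {{nonNeg*nonNeg⇒nonNeg a {{nonNegative 0≤a}} b {{nonNegative 0≤b}}}}

*-monoˡ-≤-nonNeg′ : ∀ {c a b} → 0ℚ ≤ c → a ≤ b → c * a ≤ c * b
*-monoˡ-≤-nonNeg′ {c} 0≤c = *-monoˡ-≤-nonNeg c {{nonNegative 0≤c}}

𝟙 : Bool → ℚ
𝟙 true  = 1ℚ
𝟙 false = 0ℚ

𝟙-nonNeg : ∀ b → 0ℚ ≤ 𝟙 b
𝟙-nonNeg true  = nonNegative⁻¹ 1ℚ
𝟙-nonNeg false = ≤-refl

𝟙*-≤ : ∀ b {c} → 0ℚ ≤ c → 𝟙 b * c ≤ c
𝟙*-≤ true  {c} _   = ≤-reflexive (*-identityˡ c)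
𝟙*-≤ false {c} 0≤c = ≤-trans (≤-reflexive (*-zeroˡ c)) 0≤c

𝟙-∨ : ∀ a b → 𝟙 (a ∨ b) ≤ 𝟙 a + 𝟙 b
𝟙-∨ true  b = +-monoʳ-≤ 1ℚ (𝟙-nonNeg b)
𝟙-∨ false b = ≤-reflexive (sym (+-identityˡ (𝟙 b)))

does-T : ∀ {b} (b? : Dec (T b)) → does b? ≡ b
does-T {true}  b? = dec-true b? _
does-T {false} b? = dec-false b? id

if-0-≤ : ∀ c {X} → 0ℚ ≤ X → (if c then X else 0ℚ) ≤ X
if-0-≤ true  0≤X = ≤-refl
if-0-≤ false 0≤X = 0≤X

module _ {A : Set} where

  ΣL-cong : ∀ (xs : List A) {f g : A → ℚ} → (∀ a → f a ≡ g a) → ΣL xs f ≡ ΣL xs g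
  ΣL-cong []       f≡g = refl
  ΣL-cong (x ∷ xs) f≡g = cong₂ _+_ (f≡g x) (ΣL-cong xs f≡g)

  ΣL-mono : ∀ (xs : List A) {f g : A → ℚ} → (∀ a → f a ≤ g a) → ΣL xs f ≤ ΣL xs g
  ΣL-mono []       f≤g = ≤-refl
  ΣL-mono (x ∷ xs) f≤g = +-mono-≤ (f≤g x) (ΣL-mono xs f≤g)

  ΣL-nonNeg : ∀ (xs : List A) {f : A → ℚ} → (∀ a → 0ℚ ≤ f a) → 0ℚ ≤ ΣL xs f
  ΣL-nonNeg []       0≤f = ≤-refl
  ΣL-nonNeg (x ∷ xs) 0≤f = +-mono-≤ (0≤f x) (ΣL-nonNeg xs 0≤f)

  ΣL-0 : ∀ (xs : List A) → ΣL xs (λ _ → 0ℚ) ≡ 0ℚ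
  ΣL-0 []       = refl
  ΣL-0 (x ∷ xs) = trans (+-identityˡ _) (ΣL-0 xs)

  ΣL-+ : ∀ (xs : List A) (f g : A → ℚ) → ΣL xs (λ a → f a + g a) ≡ ΣL xs f + ΣL xs g
  ΣL-+ []       f g = refl
  ΣL-+ (x ∷ xs) f g =
    trans (cong (f x + g x +_) (ΣL-+ xs f g)) (+-interchange (f x) (g x) (ΣL xs f) (ΣL xs g))

  ΣL-*ˡ : ∀ (xs : List A) (c : ℚ) (f : A → ℚ) → ΣL xs (λ a → c * f a) ≡ c * ΣL xs f
  ΣL-*ˡ []       c f = sym (*-zeroʳ c)
  ΣL-*ˡ (x ∷ xs) c f = trans (cong (c * f x +_) (ΣL-*ˡ xs c f)) (sym (*-distribˡ-+ c (f x) _))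

  ΣL-*ʳ : ∀ (xs : List A) (c : ℚ) (f : A → ℚ) → ΣL xs (λ a → f a * c) ≡ ΣL xs f * c
  ΣL-*ʳ xs c f = trans (ΣL-cong xs (λ a → *-comm (f a) c)) (trans (ΣL-*ˡ xs c f) (*-comm c _))

  ΣL-++ : ∀ (xs ys : List A) (f : A → ℚ) → ΣL (xs ++ ys) f ≡ ΣL xs f + ΣL ys f
  ΣL-++ []       ys f = sym (+-identityˡ _)
  ΣL-++ (x ∷ xs) ys f = trans (cong (f x +_) (ΣL-++ xs ys f)) (sym (+-assoc (f x) _ _))

  ΣL-map : ∀ {B : Set} (h : B → A) (xs : List B) (f : A → ℚ) → ΣL (map h xs) f ≡ ΣL xs (f ∘ h)
  ΣL-map h []       f = refl
  ΣL-map h (x ∷ xs) f = cong (f (h x) +_) (ΣL-map h xs f)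

  ΣL-concatMap : ∀ {B : Set} (F : B → List A) (xs : List B) (f : A → ℚ) →
    ΣL (concatMap F xs) f ≡ ΣL xs (λ b → ΣL (F b) f)
  ΣL-concatMap F []       f = refl
  ΣL-concatMap F (x ∷ xs) f =
    trans (ΣL-++ (F x) (concatMap F xs) f) (cong (ΣL (F x) f +_) (ΣL-concatMap F xs f))

  ΣL-filter : ∀ {P : A → Set} (P? : Decidable P) (xs : List A) (f : A → ℚ) →
    ΣL (filter P? xs) f ≡ ΣL xs (λ a → 𝟙 (does (P? a)) * f a)
  ΣL-filter P? []       f = refl
  ΣL-filter P? (x ∷ xs) f with does (P? x)
  ... | true  = cong₂ _+_ (sym (*-identityˡ (f x))) (ΣL-filter P? xs f)
  ... | false = trans (ΣL-filter P? xs f) (sym (trans (cong (_+ _) (*-zeroˡ (f x))) (+-identityˡ _)))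

  ΣL-filterᵀ : ∀ (p : A → Bool) (P? : ∀ a → Dec (T (p a))) (xs : List A) (f : A → ℚ) →
    ΣL (filter P? xs) f ≡ ΣL xs (λ a → 𝟙 (p a) * f a)
  ΣL-filterᵀ p P? xs f =
    trans (ΣL-filter P? xs f) (ΣL-cong xs (λ a → cong (λ b → 𝟙 b * f a) (does-T (P? a))))

ΣL-swap : ∀ {A B : Set} (xs : List A) (ys : List B) (f : A → B → ℚ) →
  ΣL xs (λ a → ΣL ys (f a)) ≡ ΣL ys (λ b → ΣL xs (λ a → f a b))
ΣL-swap []       ys f = sym (ΣL-0 ys)
ΣL-swap (x ∷ xs) ys f =
  trans (cong (ΣL ys (f x) +_) (ΣL-swap xs ys f)) (sym (ΣL-+ ys (f x) (λ b → ΣL xs (λ a → f a b))))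

ΠL-nonNeg : ∀ {A : Set} (xs : List A) {f : A → ℚ} → (∀ a → 0ℚ ≤ f a) → 0ℚ ≤ ΠL xs f
ΠL-nonNeg []       0≤f = nonNegative⁻¹ 1ℚ
ΠL-nonNeg (x ∷ xs) 0≤f = *-nonNeg (0≤f x) (ΠL-nonNeg xs 0≤f)

ΠL-map : ∀ {A B : Set} (h : B → A) (xs : List B) (f : A → ℚ) → ΠL (map h xs) f ≡ ΠL xs (f ∘ h)
ΠL-map h []       f = refl
ΠL-map h (x ∷ xs) f = cong (f (h x) *_) (ΠL-map h xs f)

allFin-suc : ∀ m → allFin (suc m) ≡ zero ∷ map suc (allFin m)
allFin-suc m = cong (zero ∷_) (sym (map-tabulate id suc))

ΣF-suc : ∀ m (f : Fin (suc m) → ℚ) → ΣF (suc m) f ≡ f zero + ΣF m (f ∘ suc)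
ΣF-suc m f = trans (cong (λ xs → ΣL xs f) (allFin-suc m)) (cong (f zero +_) (ΣL-map suc (allFin m) f))

ΠF-suc : ∀ m (f : Fin (suc m) → ℚ) → ΠL (allFin (suc m)) f ≡ f zero * ΠL (allFin m) (f ∘ suc)
ΠF-suc m f = trans (cong (λ xs → ΠL xs f) (allFin-suc m)) (cong (f zero *_) (ΠL-map suc (allFin m) f))

ΣF-δ : ∀ m (q : Fin m → ℚ) (j : Fin m) → ΣF m (λ k → q k * 𝟙 (does (k ≟ j))) ≡ q j
ΣF-δ (suc m) q zero = begin
  ΣF (suc m) (λ k → q k * 𝟙 (does (k ≟ zero)))
    ≡⟨ ΣF-suc m (λ k → q k * 𝟙 (does (k ≟ zero))) ⟩
  q zero * 1ℚ + ΣF m (λ k → q (suc k) * 0ℚ)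
    ≡⟨ cong₂ _+_ (*-identityʳ (q zero)) (ΣL-cong (allFin m) (λ k → *-zeroʳ (q (suc k)))) ⟩
  q zero + ΣF m (λ _ → 0ℚ)
    ≡⟨ trans (cong (q zero +_) (ΣL-0 (allFin m))) (+-identityʳ _) ⟩
  q zero
    ∎
  where open ≡-Reasoning
ΣF-δ (suc m) q (suc j) =
  trans (ΣF-suc m (λ k → q k * 𝟙 (does (k ≟ suc j))))
        (trans (cong₂ _+_ (*-zeroʳ (q zero)) (ΣF-δ m (q ∘ suc) j)) (+-identityˡ _))

_≟ˢ_ : ∀ {n} → DecidableEquality (Subset n)
_≟ˢ_ = ≡-dec Bool._≟_

ΣL-allSubsets-suc : ∀ n (f : Subset (suc n) → ℚ) →
  ΣL (allSubsets (suc n)) f ≡ ΣL (allSubsets n) (λ S → f (false ∷ S) + f (true ∷ S))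
ΣL-allSubsets-suc n f =
  trans (ΣL-concatMap (λ S → (false ∷ S) ∷ (true ∷ S) ∷ []) (allSubsets n) f)
        (ΣL-cong (allSubsets n) (λ S → cong (f (false ∷ S) +_) (+-identityʳ (f (true ∷ S)))))

ΣL-allSubsets-δ : ∀ n (F : Subset n → ℚ) (S₀ : Subset n) →
  ΣL (allSubsets n) (λ S → F S * 𝟙 (does (S₀ ≟ˢ S))) ≡ F S₀
ΣL-allSubsets-δ zero F [] = trans (+-identityʳ _) (*-identityʳ (F []))
ΣL-allSubsets-δ (suc n) F (false ∷ S₀) =
  trans (ΣL-allSubsets-suc n (λ S → F S * 𝟙 (does ((false ∷ S₀) ≟ˢ S))))
        (trans (ΣL-cong (allSubsets n) drop-true) (ΣL-allSubsets-δ n (F ∘ (false ∷_)) S₀))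
  where
  drop-true : ∀ S → F (false ∷ S) * 𝟙 (does (S₀ ≟ˢ S)) + F (true ∷ S) * 0ℚ ≡ F (false ∷ S) * 𝟙 (does (S₀ ≟ˢ S))
  drop-true S = trans (cong (F (false ∷ S) * _ +_) (*-zeroʳ (F (true ∷ S)))) (+-identityʳ _)
ΣL-allSubsets-δ (suc n) F (true ∷ S₀) =
  trans (ΣL-allSubsets-suc n (λ S → F S * 𝟙 (does ((true ∷ S₀) ≟ˢ S))))
        (trans (ΣL-cong (allSubsets n) drop-false) (ΣL-allSubsets-δ n (F ∘ (true ∷_)) S₀))
  where
  drop-false : ∀ S → F (false ∷ S) * 0ℚ + F (true ∷ S) * 𝟙 (does (S₀ ≟ˢ S)) ≡ F (true ∷ S) * 𝟙 (does (S₀ ≟ˢ S))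
  drop-false S = trans (cong (_+ F (true ∷ S) * _) (*-zeroʳ (F (false ∷ S)))) (+-identityˡ _)

ℕ→ℚ-mkℚ : ∀ n → ℕ→ℚ n ≡ mkℚ (ℤ.+ n) 0 (Coprime.sym (1-coprimeTo n))
ℕ→ℚ-mkℚ n = normalize-coprime _

ℕ→ℚ-suc : ∀ n → ℕ→ℚ (suc n) ≡ 1ℚ + ℕ→ℚ n
ℕ→ℚ-suc n =
  sym (trans (cong (1ℚ +_) (ℕ→ℚ-mkℚ n)) (/-cong (cong (λ z → ℤ.1ℤ ℤ.+ z) (ℤ.*-identityʳ (ℤ.+ n))) refl))

ℕ→ℚ-*-inverse : ∀ n .{{_ : NonZero n}} → ℕ→ℚ n * (ℤ.+ 1 / n) ≡ 1ℚ
ℕ→ℚ-*-inverse (suc k) rewrite ℕ→ℚ-mkℚ (suc k) | normalize-coprime {1} {k} (1-coprimeTo _) =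
  *-inverseʳ (mkℚ (ℤ.+ suc k) 0 (Coprime.sym (1-coprimeTo (suc k))))

ℕ→ℚ-nonNeg : ∀ n → 0ℚ ≤ ℕ→ℚ n
ℕ→ℚ-nonNeg n = nonNegative⁻¹ (ℕ→ℚ n) {{normalize-nonNeg n 1}}

ℕ→ℚ-mono : ∀ {m n} → m ℕ.≤ n → ℕ→ℚ m ≤ ℕ→ℚ n
ℕ→ℚ-mono {n = n} z≤n = ℕ→ℚ-nonNeg n
ℕ→ℚ-mono (s≤s {m} {n} m≤n) = begin
  ℕ→ℚ (suc m)  ≡⟨ ℕ→ℚ-suc m ⟩
  1ℚ + ℕ→ℚ m   ≤⟨ +-monoʳ-≤ 1ℚ (ℕ→ℚ-mono m≤n) ⟩
  1ℚ + ℕ→ℚ n   ≡⟨ ℕ→ℚ-suc n ⟨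
  ℕ→ℚ (suc n)  ∎
  where open ≤-Reasoning

ℕ→ℚ-count : ∀ {A : Set} (p : A → Bool) (xs : List A) →
  ℕ→ℚ (foldr (λ a acc → if p a then suc acc else acc) 0 xs) ≡ ΣL xs (𝟙 ∘ p)
ℕ→ℚ-count p []       = refl
ℕ→ℚ-count p (x ∷ xs) with p x
... | true  = trans (ℕ→ℚ-suc (foldr (λ a acc → if p a then suc acc else acc) 0 xs))
                    (cong (1ℚ +_) (ℕ→ℚ-count p xs))
... | false = trans (ℕ→ℚ-count p xs) (sym (+-identityˡ _))

Pr : ∀ {m t} → (Fin m → ℚ) → Vec (Fin m) t → ℚ
Pr {t = t} q s = ΠL (allFin t) (q ∘ lookup s)

Pr-∷ : ∀ {m t} (q : Fin m → ℚ) a (s : Vec (Fin m) t) → Pr q (a ∷ s) ≡ q a * Pr q s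
Pr-∷ {t = t} q a s = ΠF-suc t (q ∘ lookup (a ∷ s))

arrivals : ∀ {m t} → Fin m → Vec (Fin m) t → ℚ
arrivals {t = t} j s = ΣF t (λ k → 𝟙 (does (lookup s k ≟ j)))

ΣL-allSeqs-suc : ∀ m t (F : Vec (Fin m) (suc t) → ℚ) →
  ΣL (allSeqs m (suc t)) F ≡ ΣL (allSeqs m t) (λ s → ΣF m (λ a → F (a ∷ s)))
ΣL-allSeqs-suc m t F =
  trans (ΣL-concatMap (λ s → map (_∷ s) (allFin m)) (allSeqs m t) F)
        (ΣL-cong (allSeqs m t) (λ s → ΣL-map (_∷ s) (allFin m) F))

module IID {m : ℕ} (q : Fin m → ℚ) (Σq≡1 : ΣF m q ≡ 1ℚ) where

  ΣF-q*c≡c : ∀ c → ΣF m (λ a → q a * c) ≡ c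
  ΣF-q*c≡c c = trans (ΣL-*ʳ (allFin m) c q) (trans (cong (_* c) Σq≡1) (*-identityˡ c))

  Pr-total : ∀ t → ΣL (allSeqs m t) (Pr q) ≡ 1ℚ
  Pr-total zero    = +-identityʳ 1ℚ
  Pr-total (suc t) = begin
    ΣL (allSeqs m (suc t)) (Pr q)                         ≡⟨ ΣL-allSeqs-suc m t (Pr q) ⟩
    ΣL (allSeqs m t) (λ s → ΣF m (λ a → Pr q (a ∷ s)))   ≡⟨ ΣL-cong (allSeqs m t) Σ-first-round ⟩
    ΣL (allSeqs m t) (Pr q)                               ≡⟨ Pr-total t ⟩
    1ℚ                                                    ∎
    where
    open ≡-Reasoning
    Σ-first-round : ∀ s → ΣF m (λ a → Pr q (a ∷ s)) ≡ Pr q s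
    Σ-first-round s = trans (ΣL-cong (allFin m) (λ a → Pr-∷ q a s)) (ΣF-q*c≡c (Pr q s))

  Pr-additive : ∀ t (f : Fin m → ℚ) →
    ΣL (allSeqs m t) (λ s → Pr q s * ΣF t (f ∘ lookup s)) ≡ ℕ→ℚ t * ΣF m (λ a → q a * f a)
  Pr-additive zero    f = sym (*-zeroˡ (ΣF m (λ a → q a * f a)))
  Pr-additive (suc t) f = begin
    ΣL (allSeqs m (suc t)) (λ s → Pr q s * ΣF (suc t) (f ∘ lookup s))
      ≡⟨ ΣL-allSeqs-suc m t (λ s → Pr q s * ΣF (suc t) (f ∘ lookup s)) ⟩
    ΣL (allSeqs m t) (λ s → ΣF m (λ a → Pr q (a ∷ s) * ΣF (suc t) (f ∘ lookup (a ∷ s))))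
      ≡⟨ ΣL-cong (allSeqs m t) Σ-first-round ⟩
    ΣL (allSeqs m t) (λ s → μ * Pr q s + Pr q s * ΣF t (f ∘ lookup s))
      ≡⟨ ΣL-+ (allSeqs m t) (λ s → μ * Pr q s) _ ⟩
    ΣL (allSeqs m t) (λ s → μ * Pr q s) + ΣL (allSeqs m t) (λ s → Pr q s * ΣF t (f ∘ lookup s))
      ≡⟨ cong₂ _+_ (trans (ΣL-*ˡ (allSeqs m t) μ (Pr q)) (trans (cong (μ *_) (Pr-total t)) (*-identityʳ μ)))
                   (Pr-additive t f) ⟩
    μ + ℕ→ℚ t * μ
      ≡⟨ trans (cong (_+ ℕ→ℚ t * μ) (sym (*-identityˡ μ))) (sym (*-distribʳ-+ μ 1ℚ (ℕ→ℚ t))) ⟩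
    (1ℚ + ℕ→ℚ t) * μ
      ≡⟨ cong (_* μ) (ℕ→ℚ-suc t) ⟨
    ℕ→ℚ (suc t) * μ ∎
    where
    open ≡-Reasoning
    μ = ΣF m (λ a → q a * f a)
    split : ∀ x y u v → (x * y) * (u + v) ≡ (x * u) * y + x * (y * v)
    split = +-*-Solver.solve 4 (λ x y u v → (x :* y) :* (u :+ v) := (x :* u) :* y :+ x :* (y :* v)) refl
      where open +-*-Solver
    Σ-first-round : ∀ s → ΣF m (λ a → Pr q (a ∷ s) * ΣF (suc t) (f ∘ lookup (a ∷ s)))
                  ≡ μ * Pr q s + Pr q s * ΣF t (f ∘ lookup s)
    Σ-first-round s = begin
      ΣF m (λ a → Pr q (a ∷ s) * ΣF (suc t) (f ∘ lookup (a ∷ s)))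
        ≡⟨ ΣL-cong (allFin m) (λ a → trans (cong₂ _*_ (Pr-∷ q a s) (ΣF-suc t (f ∘ lookup (a ∷ s))))
                                           (split (q a) P (f a) X)) ⟩
      ΣF m (λ a → (q a * f a) * P + q a * (P * X))
        ≡⟨ ΣL-+ (allFin m) (λ a → (q a * f a) * P) (λ a → q a * (P * X)) ⟩
      ΣF m (λ a → (q a * f a) * P) + ΣF m (λ a → q a * (P * X))
        ≡⟨ cong₂ _+_ (ΣL-*ʳ (allFin m) P (λ a → q a * f a)) (ΣF-q*c≡c (P * X)) ⟩
      μ * P + P * X ∎
      where
      P = Pr q s
      X = ΣF t (f ∘ lookup s)

  Pr-arrivals : ∀ t j → ΣL (allSeqs m t) (λ s → Pr q s * arrivals j s) ≡ ℕ→ℚ t * q j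
  Pr-arrivals t j = trans (Pr-additive t (λ a → 𝟙 (does (a ≟ j)))) (cong (ℕ→ℚ t *_) (ΣF-δ m q j))

lookup-⁅⁆ : ∀ {n} (x j : Fin n) → lookup ⁅ x ⁆ j ≡ does (x ≟ j)
lookup-⁅⁆ zero    zero    = refl
lookup-⁅⁆ zero    (suc j) = lookup-replicate j false
lookup-⁅⁆ (suc x) zero    = refl
lookup-⁅⁆ (suc x) (suc j) = lookup-⁅⁆ x j

∪-least : ∀ {n} {p q r : Subset n} → p ⊆ r → q ⊆ r → p ∪ q ⊆ r
∪-least {p = p} {q} p⊆r q⊆r x∈p∪q with x∈p∪q⁻ p q x∈p∪q
... | inj₁ x∈p = p⊆r x∈p
... | inj₂ x∈q = q⊆r x∈q

⁅⁆-⊆ : ∀ {n} {x : Fin n} {p : Subset n} → x ∈ p → ⁅ x ⁆ ⊆ p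
⁅⁆-⊆ {x = x} {p} x∈p y∈⁅x⁆ = subst (_∈ p) (sym (x∈⁅y⁆⇒x≡y x y∈⁅x⁆)) x∈p

∣p∪q∣≤∣p∣+∣q∣ : ∀ {n} (p q : Subset n) → ∣ p ∪ q ∣ ℕ.≤ ∣ p ∣ ℕ.+ ∣ q ∣
∣p∪q∣≤∣p∣+∣q∣ []          []          = z≤n
∣p∪q∣≤∣p∣+∣q∣ (true  ∷ p) (true  ∷ q) = s≤s (ℕ.≤-trans (∣p∪q∣≤∣p∣+∣q∣ p q) (ℕ.+-monoʳ-≤ ∣ p ∣ (ℕ.n≤1+n _)))
∣p∪q∣≤∣p∣+∣q∣ (true  ∷ p) (false ∷ q) = s≤s (∣p∪q∣≤∣p∣+∣q∣ p q)
∣p∪q∣≤∣p∣+∣q∣ (false ∷ p) (true  ∷ q) rewrite ℕ.+-suc ∣ p ∣ ∣ q ∣ = s≤s (∣p∪q∣≤∣p∣+∣q∣ p q)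
∣p∪q∣≤∣p∣+∣q∣ (false ∷ p) (false ∷ q) = ∣p∪q∣≤∣p∣+∣q∣ p q

⊆⇒isSubsetB : ∀ {n} (p q : Subset n) → p ⊆ q → isSubsetB p q ≡ true
⊆⇒isSubsetB []          []          p⊆q = refl
⊆⇒isSubsetB (false ∷ p) (_ ∷ q)     p⊆q = ⊆⇒isSubsetB p q (drop-∷-⊆ p⊆q)
⊆⇒isSubsetB (true ∷ p)  (true ∷ q)  p⊆q = ⊆⇒isSubsetB p q (drop-∷-⊆ p⊆q)
⊆⇒isSubsetB (true ∷ p)  (false ∷ q) p⊆q with p⊆q here
... | ()

≤⇒leqB : ∀ {m n} → m ℕ.≤ n → leqB m n ≡ true
≤⇒leqB z≤n       = refl
≤⇒leqB (s≤s m≤n) = ≤⇒leqB m≤n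

-- assignedTypes s A i is typesOf (λ k → A k i) (lookup s) (allFin T),
-- generalised to an arbitrary list of rounds for the induction.
module TypesOf {t n : ℕ} (a : Fin t → Bool) (σ : Fin t → Fin n) where

  typesOf : List (Fin t) → Subset n
  typesOf = foldr (λ k acc → if a k then ⁅ σ k ⁆ ∪ acc else acc) ⊥

  count : List (Fin t) → ℕ
  count = foldr (λ k acc → if a k then suc acc else acc) 0

  typesOf-⊆ : ∀ {N} → (∀ k → a k ≡ true → σ k ∈ N) → ∀ ks → typesOf ks ⊆ N
  typesOf-⊆ σ∈N []       = ⊥⊆
  typesOf-⊆ σ∈N (k ∷ ks) with a k in ak
  ... | true  = ∪-least (⁅⁆-⊆ (σ∈N k ak)) (typesOf-⊆ σ∈N ks)
  ... | false = typesOf-⊆ σ∈N ks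

  ∣typesOf∣≤count : ∀ ks → ∣ typesOf ks ∣ ℕ.≤ count ks
  ∣typesOf∣≤count []       = ℕ.≤-reflexive (∣⊥∣≡0 n)
  ∣typesOf∣≤count (k ∷ ks) with a k
  ... | true  = ℕ.≤-trans (∣p∪q∣≤∣p∣+∣q∣ ⁅ σ k ⁆ (typesOf ks))
                  (subst (λ c → c ℕ.+ _ ℕ.≤ _) (sym (∣⁅x⁆∣≡1 (σ k))) (s≤s (∣typesOf∣≤count ks)))
  ... | false = ∣typesOf∣≤count ks

  𝟙-typesOf : ∀ j ks → 𝟙 (lookup (typesOf ks) j) ≤ ΣL ks (λ k → 𝟙 (a k) * 𝟙 (does (σ k ≟ j)))
  𝟙-typesOf j []       = ≤-reflexive (cong 𝟙 (lookup-replicate j false))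
  𝟙-typesOf j (k ∷ ks) with a k
  ... | true  = begin
    𝟙 (lookup (⁅ σ k ⁆ ∪ typesOf ks) j)
      ≡⟨ cong 𝟙 (trans (lookup-zipWith _∨_ j ⁅ σ k ⁆ (typesOf ks)) (cong (_∨ _) (lookup-⁅⁆ (σ k) j))) ⟩
    𝟙 (does (σ k ≟ j) ∨ lookup (typesOf ks) j)
      ≤⟨ 𝟙-∨ (does (σ k ≟ j)) _ ⟩
    𝟙 (does (σ k ≟ j)) + 𝟙 (lookup (typesOf ks) j)
      ≤⟨ +-mono-≤ (≤-reflexive (sym (*-identityˡ (𝟙 (does (σ k ≟ j)))))) (𝟙-typesOf j ks) ⟩
    1ℚ * 𝟙 (does (σ k ≟ j)) + ΣL ks (λ k → 𝟙 (a k) * 𝟙 (does (σ k ≟ j))) ∎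
    where open ≤-Reasoning
  ... | false = ≤-trans (𝟙-typesOf j ks)
                  (≤-reflexive (sym (trans (cong (_+ rest) (*-zeroˡ (𝟙 (does (σ k ≟ j))))) (+-identityˡ rest))))
    where rest = ΣL ks (λ k → 𝟙 (a k) * 𝟙 (does (σ k ≟ j)))

module ClairvoyantLP
    {nI nJ : ℕ} (Nb : Fin nI → Subset nJ) (bI : Fin nI → ℕ) (bJ : Fin nJ → ℕ)
    (T : ℕ) .{{_ : NonZero T}} (r : Fin nJ → ℚ) (r>0 : ∀ j → 0ℚ < r j) (Σr≡T : ΣF nJ r ≡ ℕ→ℚ T)
    (A : Vec (Fin nJ) T → Assignment nI T)
    (feasible : ∀ s → FeasibleAssignment Nb bI bJ s (A s)) where

  q : Fin nJ → ℚ
  q j = r j * (ℤ.+ 1 / T)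

  Σq≡1 : ΣF nJ q ≡ 1ℚ
  Σq≡1 = trans (ΣL-*ʳ (allFin nJ) (ℤ.+ 1 / T) r) (trans (cong (_* (ℤ.+ 1 / T)) Σr≡T) (ℕ→ℚ-*-inverse T))

  open IID q Σq≡1

  Pr-nonNeg : ∀ s → 0ℚ ≤ Pr q s
  Pr-nonNeg s = ΠL-nonNeg (allFin T)
    (λ k → *-nonNeg (<⇒≤ (r>0 (lookup s k))) (nonNegative⁻¹ (ℤ.+ 1 / T) {{normalize-nonNeg 1 T}}))

  -- seqProb T r is Pr q, so expectedValue T r g A is 𝔼 of the assignment value.
  𝔼 : (Vec (Fin nJ) T → ℚ) → ℚ
  𝔼 h = ΣL (allSeqs nJ T) (λ s → Pr q s * h s)

  𝔼-cong : ∀ {h h′} → (∀ s → h s ≡ h′ s) → 𝔼 h ≡ 𝔼 h′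
  𝔼-cong h≡h′ = ΣL-cong (allSeqs nJ T) (λ s → cong (Pr q s *_) (h≡h′ s))

  𝔼-mono : ∀ {h h′} → (∀ s → h s ≤ h′ s) → 𝔼 h ≤ 𝔼 h′
  𝔼-mono h≤h′ = ΣL-mono (allSeqs nJ T) (λ s → *-monoˡ-≤-nonNeg′ (Pr-nonNeg s) (h≤h′ s))

  𝔼-nonNeg : ∀ {h} → (∀ s → 0ℚ ≤ h s) → 0ℚ ≤ 𝔼 h
  𝔼-nonNeg 0≤h = ΣL-nonNeg (allSeqs nJ T) (λ s → *-nonNeg (Pr-nonNeg s) (0≤h s))

  𝔼-*ˡ : ∀ c h → 𝔼 (λ s → c * h s) ≡ c * 𝔼 h
  𝔼-*ˡ c h = trans (ΣL-cong (allSeqs nJ T) (λ s → x*yz≡y*xz (Pr q s) c (h s))) (ΣL-*ˡ (allSeqs nJ T) c _)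

  ΣL-𝔼 : ∀ {B : Set} (xs : List B) (h : B → Vec (Fin nJ) T → ℚ) →
    ΣL xs (λ b → 𝔼 (h b)) ≡ 𝔼 (λ s → ΣL xs (λ b → h b s))
  ΣL-𝔼 xs h = trans (ΣL-swap xs (allSeqs nJ T) (λ b s → Pr q s * h b s))
                    (ΣL-cong (allSeqs nJ T) (λ s → ΣL-*ˡ xs (Pr q s) (λ b → h b s)))

  𝔼-1 : 𝔼 (λ _ → 1ℚ) ≡ 1ℚ
  𝔼-1 = trans (ΣL-cong (allSeqs nJ T) (λ s → *-identityʳ (Pr q s))) (Pr-total T)

  𝔼-arrivals : ∀ j → 𝔼 (arrivals j) ≡ r j
  𝔼-arrivals j = begin
    𝔼 (arrivals j)                          ≡⟨ Pr-arrivals T j ⟩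
    ℕ→ℚ T * (r j * (ℤ.+ 1 / T))             ≡⟨ x*yz≡y*xz (ℕ→ℚ T) (r j) _ ⟩
    r j * (ℕ→ℚ T * (ℤ.+ 1 / T))             ≡⟨ cong (r j *_) (ℕ→ℚ-*-inverse T) ⟩
    r j * 1ℚ                                ≡⟨ *-identityʳ (r j) ⟩
    r j                                     ∎
    where open ≡-Reasoning

  S : Vec (Fin nJ) T → Fin nI → Subset nJ
  S s = assignedTypes s (A s)

  inΛ : Fin nI → Subset nJ → Bool
  inΛ i S₀ = isSubsetB S₀ (Nb i) ∧ leqB ∣ S₀ ∣ (bI i)

  S∈Λ : ∀ s i → inΛ i (S s i) ≡ true
  S∈Λ s i = cong₂ _∧_
    (⊆⇒isSubsetB (S s i) (Nb i) (typesOf-⊆ (λ k → proj₁ (feasible s) k i) (allFin T)))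
    (≤⇒leqB (ℕ.≤-trans (∣typesOf∣≤count (allFin T)) (proj₂ (proj₂ (feasible s)) i)))
    where open TypesOf (λ k → A s k i) (lookup s)

  𝟙[j∈Sᵢ]≤arrivals : ∀ s i j → 𝟙 (lookup (S s i) j) ≤ arrivals j s
  𝟙[j∈Sᵢ]≤arrivals s i j =
    ≤-trans (𝟙-typesOf j (allFin T))
            (ΣL-mono (allFin T) (λ k → 𝟙*-≤ (A s k i) (𝟙-nonNeg (does (lookup s k ≟ j)))))
    where open TypesOf (λ k → A s k i) (lookup s)

  Σᵢ𝟙[j∈Sᵢ]≤bⱼ*arrivals : ∀ s j → ΣF nI (λ i → 𝟙 (lookup (S s i) j)) ≤ ℕ→ℚ (bJ j) * arrivals j s
  Σᵢ𝟙[j∈Sᵢ]≤bⱼ*arrivals s j = begin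
    ΣF nI (λ i → 𝟙 (lookup (S s i) j))
      ≤⟨ ΣL-mono (allFin nI) (λ i → TypesOf.𝟙-typesOf (λ k → A s k i) (lookup s) j (allFin T)) ⟩
    ΣF nI (λ i → ΣF T (λ k → 𝟙 (A s k i) * e k))
      ≡⟨ ΣL-swap (allFin nI) (allFin T) (λ i k → 𝟙 (A s k i) * e k) ⟩
    ΣF T (λ k → ΣF nI (λ i → 𝟙 (A s k i) * e k))
      ≡⟨ ΣL-cong (allFin T) (λ k → ΣL-*ʳ (allFin nI) (e k) (λ i → 𝟙 (A s k i))) ⟩
    ΣF T (λ k → ΣF nI (λ i → 𝟙 (A s k i)) * e k)
      ≤⟨ ΣL-mono (allFin T) served≤bⱼ ⟩
    ΣF T (λ k → ℕ→ℚ (bJ j) * e k)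
      ≡⟨ ΣL-*ˡ (allFin T) (ℕ→ℚ (bJ j)) e ⟩
    ℕ→ℚ (bJ j) * arrivals j s ∎
    where
    open ≤-Reasoning
    e : Fin T → ℚ
    e k = 𝟙 (does (lookup s k ≟ j))
    served≤bⱼ : ∀ k → ΣF nI (λ i → 𝟙 (A s k i)) * e k ≤ ℕ→ℚ (bJ j) * e k
    served≤bⱼ k with lookup s k ≟ j
    ... | yes refl = *-monoʳ-≤-nonNeg 1ℚ (begin
      ΣF nI (λ i → 𝟙 (A s k i))  ≡⟨ ℕ→ℚ-count (A s k) (allFin nI) ⟨
      ℕ→ℚ (countF nI (A s k))    ≤⟨ ℕ→ℚ-mono (proj₁ (proj₂ (feasible s)) k) ⟩
      ℕ→ℚ (bJ (lookup s k))      ∎)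
    ... | no _     = ≤-reflexive (trans (*-zeroʳ (ΣF nI (λ i → 𝟙 (A s k i)))) (sym (*-zeroʳ (ℕ→ℚ (bJ j)))))

  x : Fin nI → Subset nJ → ℚ
  x i S₀ = 𝔼 (λ s → 𝟙 (does (S s i ≟ˢ S₀)))

  x-nonNeg : ∀ i S₀ → 0ℚ ≤ x i S₀
  x-nonNeg i S₀ = 𝔼-nonNeg (λ s → 𝟙-nonNeg (does (S s i ≟ˢ S₀)))

  ΣΛ-δ : ∀ s i (F : Subset nJ → ℚ) →
    ΣL (Λ Nb bI i) (λ S₀ → F S₀ * 𝟙 (does (S s i ≟ˢ S₀))) ≡ F (S s i)
  ΣΛ-δ s i F = begin
    ΣL (Λ Nb bI i) (λ S₀ → F S₀ * δ S₀)
      ≡⟨ ΣL-filterᵀ (inΛ i) _ (allSubsets nJ) (λ S₀ → F S₀ * δ S₀) ⟩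
    ΣL (allSubsets nJ) (λ S₀ → 𝟙 (inΛ i S₀) * (F S₀ * δ S₀))
      ≡⟨ ΣL-cong (allSubsets nJ) (λ S₀ → sym (*-assoc (𝟙 (inΛ i S₀)) (F S₀) (δ S₀))) ⟩
    ΣL (allSubsets nJ) (λ S₀ → (𝟙 (inΛ i S₀) * F S₀) * δ S₀)
      ≡⟨ ΣL-allSubsets-δ nJ (λ S₀ → 𝟙 (inΛ i S₀) * F S₀) (S s i) ⟩
    𝟙 (inΛ i (S s i)) * F (S s i)
      ≡⟨ cong (λ b → 𝟙 b * F (S s i)) (S∈Λ s i) ⟩
    1ℚ * F (S s i)
      ≡⟨ *-identityˡ (F (S s i)) ⟩
    F (S s i) ∎
    where
    open ≡-Reasoning
    δ : Subset nJ → ℚ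
    δ S₀ = 𝟙 (does (S s i ≟ˢ S₀))

  ΣΛ-*x : ∀ i (F : Subset nJ → ℚ) → ΣL (Λ Nb bI i) (λ S₀ → F S₀ * x i S₀) ≡ 𝔼 (λ s → F (S s i))
  ΣΛ-*x i F = begin
    ΣL (Λ Nb bI i) (λ S₀ → F S₀ * x i S₀)
      ≡⟨ ΣL-cong (Λ Nb bI i) (λ S₀ → sym (𝔼-*ˡ (F S₀) _)) ⟩
    ΣL (Λ Nb bI i) (λ S₀ → 𝔼 (λ s → F S₀ * 𝟙 (does (S s i ≟ˢ S₀))))
      ≡⟨ ΣL-𝔼 (Λ Nb bI i) _ ⟩
    𝔼 (λ s → ΣL (Λ Nb bI i) (λ S₀ → F S₀ * 𝟙 (does (S s i ≟ˢ S₀))))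
      ≡⟨ 𝔼-cong (λ s → ΣΛ-δ s i F) ⟩
    𝔼 (λ s → F (S s i)) ∎
    where open ≡-Reasoning

  ΣΛ₂-x : ∀ i j → ΣL (Λ₂ Nb bI i j) (x i) ≡ 𝔼 (λ s → 𝟙 (lookup (S s i) j))
  ΣΛ₂-x i j =
    trans (ΣL-filterᵀ (λ S₀ → lookup S₀ j) _ (Λ Nb bI i) (x i)) (ΣΛ-*x i (λ S₀ → 𝟙 (lookup S₀ j)))

  x-feasible : LPFeasible Nb bI bJ r x
  x-feasible = ΣΛ-x≤1 , ΣΛ₂-x≤r , Σᵢ-ΣΛ₂-x≤r*b , λ i S₀ _ → x-nonNeg i S₀
    where
    ΣΛ-x≤1 : ∀ i → ΣL (Λ Nb bI i) (x i) ≤ 1ℚ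
    ΣΛ-x≤1 i = ≤-reflexive (begin
      ΣL (Λ Nb bI i) (x i)                    ≡⟨ ΣL-cong (Λ Nb bI i) (λ S₀ → sym (*-identityˡ (x i S₀))) ⟩
      ΣL (Λ Nb bI i) (λ S₀ → 1ℚ * x i S₀)     ≡⟨ ΣΛ-*x i (λ _ → 1ℚ) ⟩
      𝔼 (λ _ → 1ℚ)                            ≡⟨ 𝔼-1 ⟩
      1ℚ                                      ∎)
      where open ≡-Reasoning

    ΣΛ₂-x≤r : ∀ j i → j ∈ Nb i → ΣL (Λ₂ Nb bI i j) (x i) ≤ r j
    ΣΛ₂-x≤r j i _ = begin
      ΣL (Λ₂ Nb bI i j) (x i)              ≡⟨ ΣΛ₂-x i j ⟩
      𝔼 (λ s → 𝟙 (lookup (S s i) j))      ≤⟨ 𝔼-mono (λ s → 𝟙[j∈Sᵢ]≤arrivals s i j) ⟩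
      𝔼 (arrivals j)                       ≡⟨ 𝔼-arrivals j ⟩
      r j                                  ∎
      where open ≤-Reasoning

    Σᵢ-ΣΛ₂-x≤r*b : ∀ j → ΣF nI (λ i → if lookup (Nb i) j then ΣL (Λ₂ Nb bI i j) (x i) else 0ℚ)
                        ≤ r j * ℕ→ℚ (bJ j)
    Σᵢ-ΣΛ₂-x≤r*b j = begin
      ΣF nI (λ i → if lookup (Nb i) j then ΣL (Λ₂ Nb bI i j) (x i) else 0ℚ)
        ≤⟨ ΣL-mono (allFin nI) (λ i → if-0-≤ (lookup (Nb i) j) (ΣL-nonNeg (Λ₂ Nb bI i j) (x-nonNeg i))) ⟩
      ΣF nI (λ i → ΣL (Λ₂ Nb bI i j) (x i))
        ≡⟨ ΣL-cong (allFin nI) (λ i → ΣΛ₂-x i j) ⟩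
      ΣF nI (λ i → 𝔼 (λ s → 𝟙 (lookup (S s i) j)))
        ≡⟨ ΣL-𝔼 (allFin nI) (λ i s → 𝟙 (lookup (S s i) j)) ⟩
      𝔼 (λ s → ΣF nI (λ i → 𝟙 (lookup (S s i) j)))
        ≤⟨ 𝔼-mono (λ s → Σᵢ𝟙[j∈Sᵢ]≤bⱼ*arrivals s j) ⟩
      𝔼 (λ s → ℕ→ℚ (bJ j) * arrivals j s)
        ≡⟨ trans (𝔼-*ˡ (ℕ→ℚ (bJ j)) (arrivals j)) (cong (ℕ→ℚ (bJ j) *_) (𝔼-arrivals j)) ⟩
      ℕ→ℚ (bJ j) * r j
        ≡⟨ *-comm (ℕ→ℚ (bJ j)) (r j) ⟩
      r j * ℕ→ℚ (bJ j) ∎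
      where open ≤-Reasoning

  x-objective : ∀ g → LPObjective Nb bI g x ≡ expectedValue T r g A
  x-objective g = begin
    ΣF nI (λ i → ΣL (Λ Nb bI i) (λ S₀ → g i S₀ * x i S₀))
      ≡⟨ ΣL-cong (allFin nI) (λ i → ΣΛ-*x i (g i)) ⟩
    ΣF nI (λ i → 𝔼 (λ s → g i (S s i)))
      ≡⟨ ΣL-𝔼 (allFin nI) (λ i s → g i (S s i)) ⟩
    𝔼 (λ s → ΣF nI (λ i → g i (S s i))) ∎
    where open ≡-Reasoning

lemma5 : (nI nJ : ℕ) (Nb : Fin nI → Subset nJ) (bI : Fin nI → ℕ) (bJ : Fin nJ → ℕ)
    (T : ℕ) .{{_ : NonZero T}} (r : Fin nJ → ℚ) (g : Fin nI → Subset nJ → ℚ) →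
    (∀ i → 1 ℕ.≤ bI i) → (∀ j → 1 ℕ.≤ bJ j) →
    (∀ j → 0ℚ < r j) → ΣF nJ r ≡ ℕ→ℚ T →
    (∀ i → g i ⊥ ≡ 0ℚ) → (∀ i S → S ⊆ Nb i → 0ℚ ≤ g i S) →
    (∀ i → Monotone (Nb i) (g i)) → (∀ i → Submodular (Nb i) (g i)) →
    (A : Vec (Fin nJ) T → Assignment nI T) →
    (∀ s → FeasibleAssignment Nb bI bJ s (A s)) →
    Σ (Fin nI → Subset nJ → ℚ) λ x →
      LPFeasible Nb bI bJ r x × expectedValue T r g A ≤ LPObjective Nb bI g x
lemma5 nI nJ Nb bI bJ T r g _ _ r>0 Σr≡T _ _ _ _ A feasible =
  x , x-feasible , ≤-reflexive (sym (x-objective g))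
  where open ClairvoyantLP Nb bI bJ T r r>0 Σr≡T A feasible
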